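{- Let $G$ be a group, $k\geq2$, and $A\subseteq G$ a $k$-stable set. Then the relation $\phi_A\subseteq G\times G^2$ defined by $\phi_A(x;y,z)\iff x\in Ay\triangle Az$ is $n$-stable, where $n=R\big(R(k,k+1),R(k,k+1)\big)+1$.
   Context: A subset $A\subseteq G$ is $k$-stable if there are no $a_1,\ldots,a_k,b_1,\ldots,b_k\in G$ with $a_ib_j\in A$ iff $i\le j$. A relation $\phi\subseteq X\times Y$ is $n$-stable if there are no $a_1,\ldots,a_n\in X$, $b_1,\ldots,b_n\in Y$ with $(a_i,b_j)\in\phi$ iff $i\leq j$. $R(k,\ell)$ is the two-colour graph Ramsey number. -}

module Defs where

open import Level using (Level; _⊔_)
open import Data.Nat using (ℕ; suc)
open import Data.Bool using (Bool; true; false)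
open import Data.Fin using (Fin; toℕ)
open import Data.Product using (Σ; ∃; _×_; _,_)
open import Data.Sum using (_⊎_)
open import Relation.Nullary using (¬_)
open import Relation.Binary.PropositionalEquality using (_≡_)
open import Function.Bundles using (_⇔_)
open import Algebra.Bundles using (Group)

_≤ᶠ_ : ∀ {n} → Fin n → Fin n → Set
i ≤ᶠ j = toℕ i Data.Nat.≤ toℕ j

_<ᶠ_ : ∀ {n} → Fin n → Fin n → Set
i <ᶠ j = toℕ i Data.Nat.< toℕ j

-- A 2-colouring of the edges of the complete graph on Fin N: the colour of
-- the edge {u,v} with u < v is c u v (values with u ≥ v are ignored).
MonoClique : (N k : ℕ) → (Fin N → Fin N → Bool) → Bool → Set
MonoClique N k c b =
  Σ (Fin k → Fin N) λ f →
    (∀ i j → i <ᶠ j → f i <ᶠ f j) × (∀ i j → i <ᶠ j → c (f i) (f j) ≡ b)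

Arrows : (N k l : ℕ) → Set
Arrows N k l = ∀ (c : Fin N → Fin N → Bool) → MonoClique N k c true ⊎ MonoClique N l c false

IsRamseyNumber : (k l r : ℕ) → Set
IsRamseyNumber k l r = Arrows r k l × (∀ m → Arrows m k l → r Data.Nat.≤ m)

RelStable : ∀ {a b p} {X : Set a} {Y : Set b} → (X → Y → Set p) → ℕ → Set (a ⊔ b ⊔ p)
RelStable {X = X} {Y = Y} φ n =
  ¬ (Σ (Fin n → X) λ as → Σ (Fin n → Y) λ bs → ∀ i j → (φ (as i) (bs j) ⇔ (i ≤ᶠ j)))

module _ {c ℓ} (G : Group c ℓ) where
  open Group G

  Respects≈ : ∀ {p} → (Carrier → Set p) → Set (c ⊔ ℓ ⊔ p)
  Respects≈ A = ∀ {x y} → x ≈ y → A x → A y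

  SetStable : ∀ {p} → (Carrier → Set p) → ℕ → Set (c ⊔ p)
  SetStable A k =
    ¬ (Σ (Fin k → Carrier) λ as → Σ (Fin k → Carrier) λ bs →
         ∀ i j → (A (as i ∙ bs j) ⇔ (i ≤ᶠ j)))

  InRightTranslate : ∀ {p} → (Carrier → Set p) → Carrier → Carrier → Set (c ⊔ ℓ ⊔ p)
  InRightTranslate A y x = Σ Carrier λ a → A a × (x ≈ a ∙ y)

  φ : ∀ {p} → (Carrier → Set p) → Carrier → Carrier × Carrier → Set (c ⊔ ℓ ⊔ p)
  φ A x (y , z) =
    (InRightTranslate A y x × ¬ InRightTranslate A z x)
    ⊎ (¬ InRightTranslate A y x × InRightTranslate A z x)

-- Restrict a φ_A-ladder x_i, (y_j , z_j) to R(R(k,k+1),R(k,k+1)) indices and consider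
-- the Boolean matrix whose entry at row i and column (j , b) says whether x_i ∈ A y_j
-- (b = true) or x_i ∈ A z_j (b = false).  On and above the diagonal the two sides of a
-- column differ, below it they agree.  A first Ramsey argument makes the entries below
-- the diagonal constant, say β.  A second one colours i < j by whether the entry above
-- the diagonal differs from β when column j is taken on the side whose diagonal entry
-- is true: it leaves k indices where it always differs, or k+1 where it never does, and
-- then every column is switched to its other side.  Either way the matrix becomes
-- triangular (not β above, β below, constant on the diagonal), and after reversing
-- and/or shifting the indices it is a k-ladder for x ∈ A w, i.e. for x w⁻¹ ∈ A.
-- Membership in A is not decidable, so the argument runs under a double negation.

module Submission where

open import Defs
open import Level using (Level)
open import Data.Nat using (ℕ; suc; _≤_)
open import Algebra.Bundles using (Group)

open import Level using (_⊔_)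

open import Data.Bool using (Bool; true; false; not; _xor_; if_then_else_)
open import Data.Bool.Properties
  using (not-involutive; xor-assoc; xor-comm; xor-identityʳ; xor-inverseˡ; xor-same)
open import Data.Fin using (Fin; inject₁; inject≤; opposite)
  renaming (zero to fzero; suc to fsuc)
open import Data.Fin.Properties
  using (_≟_; ≤∧≢⇒<; ≤̄⇒inject₁<; toℕ-inject₁; toℕ-inject≤; opposite-prop; toℕ<n)
open import Data.Nat using (_<_; s≤s)
import Data.Nat.Properties as ℕ
open import Data.Product using (Σ; _×_; _,_; proj₁; proj₂)
open import Data.Sum using (_⊎_; inj₁; inj₂)
open import Function using (_∘_; id)
open import Function.Bundles using (_⇔_; mk⇔; Equivalence)
import Function.Properties.Equivalence as ⇔
open import Relation.Binary.PropositionalEquality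
  using (_≡_; refl; sym; trans; cong; subst; subst₂; module ≡-Reasoning)
open import Relation.Nullary using (¬_; Dec; yes; no; does)
open import Relation.Nullary.Decidable using (dec-true; dec-false; ¬¬-excluded-middle)
open import Relation.Nullary.Negation using (contradiction; ¬¬-map)

private
  variable
    a b a′ b′ p q : Level

¬¬-∀-Fin : ∀ {n} {P : Fin n → Set p} → (∀ i → ¬ ¬ P i) → ¬ ¬ (∀ i → P i)
¬¬-∀-Fin {n = 0} _ ¬∀ = ¬∀ λ ()
¬¬-∀-Fin {n = suc n} ¬¬P ¬∀ =
  ¬¬P fzero λ P₀ → ¬¬-∀-Fin (¬¬P ∘ fsuc) λ P₊ → ¬∀ λ { fzero → P₀ ; (fsuc i) → P₊ i }

¬¬-∀-Bool : {P : Bool → Set p} → (∀ b → ¬ ¬ P b) → ¬ ¬ (∀ b → P b)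
¬¬-∀-Bool ¬¬P ¬∀ = ¬¬P true λ Pt → ¬¬P false λ Pf → ¬∀ λ { true → Pt ; false → Pf }

does≡true⇔ : {P : Set p} (p? : Dec P) → does p? ≡ true ⇔ P
does≡true⇔ (yes p) = mk⇔ (λ _ → p) (λ _ → refl)
does≡true⇔ (no ¬p) = mk⇔ (λ ()) (λ p → contradiction p ¬p)

does-exclusive : {P Q : Set p} (p? : Dec P) (q? : Dec Q) →
                 (P × ¬ Q) ⊎ (¬ P × Q) → does q? ≡ not (does p?)
does-exclusive p? q? (inj₁ (p , ¬q)) = trans (dec-false q? ¬q) (cong not (sym (dec-true p? p)))
does-exclusive p? q? (inj₂ (¬p , q)) = trans (dec-true q? q) (cong not (sym (dec-false p? ¬p)))

does-nonexclusive : {P Q : Set p} (p? : Dec P) (q? : Dec Q) →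
                    ¬ ((P × ¬ Q) ⊎ (¬ P × Q)) → does q? ≡ does p?
does-nonexclusive (yes _) (yes _) _     = refl
does-nonexclusive (no _)  (no _)  _     = refl
does-nonexclusive (yes p) (no ¬q) ¬excl = contradiction (inj₁ (p , ¬q)) ¬excl
does-nonexclusive (no ¬p) (yes q) ¬excl = contradiction (inj₂ (¬p , q)) ¬excl

xor-solveˡ : ∀ {x y z} → x xor y ≡ z → x ≡ z xor y
xor-solveˡ {x} {y} {z} e = begin
  x                ≡⟨ xor-identityʳ x ⟨
  x xor false      ≡⟨ cong (x xor_) (xor-same y) ⟨
  x xor (y xor y)  ≡⟨ xor-assoc x y y ⟨
  (x xor y) xor y  ≡⟨ cong (_xor y) e ⟩
  z xor y          ∎
  where open ≡-Reasoning

-- RelStable R n is ¬ Ladder R n and SetStable G A k is ¬ Ladder (λ x y → A (x ∙ y)) k.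

Ladder : {X : Set a} {Y : Set b} → (X → Y → Set p) → ℕ → Set (a ⊔ b ⊔ p)
Ladder {X = X} {Y} R n =
  Σ (Fin n → X) λ xs → Σ (Fin n → Y) λ ys → ∀ i j → R (xs i) (ys j) ⇔ i ≤ᶠ j

ladder-shrink : ∀ {X : Set a} {Y : Set b} {R : X → Y → Set p} {m n} →
                m ≤ n → Ladder R n → Ladder R m
ladder-shrink {R = R} {m} {n} m≤n (xs , ys , ladder) =
  xs ∘ inject , ys ∘ inject , λ i j →
    subst₂ (λ u v → R (xs (inject i)) (ys (inject j)) ⇔ u ≤ v)
           (toℕ-inject≤ i m≤n) (toℕ-inject≤ j m≤n) (ladder (inject i) (inject j))
  where
  inject : Fin m → Fin n
  inject i = inject≤ i m≤n

ladder-comap : ∀ {X : Set a} {Y : Set b} {X′ : Set a′} {Y′ : Set b′} {R : X → Y → Set p} {n}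
               (u : X′ → X) (v : Y′ → Y) →
               Ladder (λ x y → R (u x) (v y)) n → Ladder R n
ladder-comap u v (xs , ys , ladder) = u ∘ xs , v ∘ ys , ladder

ladder-map : ∀ {X : Set a} {Y : Set b} {X′ : Set a′} {Y′ : Set b′}
             {R : X → Y → Set p} {S : X′ → Y′ → Set q} {n}
             (u : X → X′) (v : Y → Y′) → (∀ x y → S (u x) (v y) ⇔ R x y) →
             Ladder R n → Ladder S n
ladder-map u v S⇔R (xs , ys , ladder) =
  u ∘ xs , v ∘ ys , λ i j → ⇔.trans (S⇔R (xs i) (ys j)) (ladder i j)

IsTrue : {X : Set a} {Y : Set b} → (X → Y → Bool) → X → Y → Set
IsTrue E x y = E x y ≡ true

record Triangular {n} (E : Fin n → Fin n → Bool) (β d : Bool) : Set where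
  field
    above    : ∀ {i j} → i <ᶠ j → E i j ≡ not β
    diagonal : ∀ i → E i i ≡ d
    below    : ∀ {i j} → j <ᶠ i → E i j ≡ β

module _ {n} {E : Fin n → Fin n → Bool} where

  triangular⇔≤ : Triangular E false true → ∀ i j → E i j ≡ true ⇔ i ≤ᶠ j
  triangular⇔≤ T i j = mk⇔ to from
    where
    open Triangular T
    to : E i j ≡ true → i ≤ᶠ j
    to Eij = ℕ.≮⇒≥ λ j<i → contradiction (trans (sym Eij) (below j<i)) λ ()
    from : i ≤ᶠ j → E i j ≡ true
    from i≤j with i ≟ j
    ... | yes refl = diagonal i
    ... | no i≢j   = above (≤∧≢⇒< i≤j i≢j)

  opposite-reverses-< : ∀ {i j : Fin n} → i <ᶠ j → opposite j <ᶠ opposite i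
  opposite-reverses-< {i} {j} i<j =
    subst₂ _<_ (sym (opposite-prop j)) (sym (opposite-prop i))
           (ℕ.∸-monoʳ-< (s≤s i<j) (toℕ<n j))

  triangular-reverse : ∀ {β d} → Triangular E β d →
                       Triangular (λ i j → E (opposite i) (opposite j)) (not β) d
  triangular-reverse {β} T = record
    { above    = λ i<j → trans (below (opposite-reverses-< i<j)) (sym (not-involutive β))
    ; diagonal = diagonal ∘ opposite
    ; below    = λ j<i → above (opposite-reverses-< j<i)
    }
    where open Triangular T

triangular-shift : ∀ {n} {E : Fin (suc n) → Fin (suc n) → Bool} →
                   Triangular E false false →
                   Triangular (λ i j → E (inject₁ i) (fsuc j)) false true
triangular-shift {E = E} T = record
  { above    = λ i<j → above (≤̄⇒inject₁< (ℕ.<⇒≤ i<j))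
  ; diagonal = λ i → above (≤̄⇒inject₁< ℕ.≤-refl)
  ; below    = λ {i} j<i →
      onOrBelow (subst (suc _ ≤_) (sym (toℕ-inject₁ i)) j<i)
  }
  where
  open Triangular T
  onOrBelow : ∀ {i j} → j ≤ᶠ i → E i j ≡ false
  onOrBelow {i} {j} j≤i with j ≟ i
  ... | yes refl = diagonal i
  ... | no j≢i   = below (≤∧≢⇒< j≤i j≢i)

ladder-of-triangular-true : ∀ {n β} {E : Fin n → Fin n → Bool} →
                            Triangular E β true → Ladder (IsTrue E) n
ladder-of-triangular-true {β = false} T = id , id , triangular⇔≤ T
ladder-of-triangular-true {β = true}  T =
  opposite , opposite , triangular⇔≤ (triangular-reverse T)

ladder-of-triangular-false : ∀ {n β} {E : Fin (suc n) → Fin (suc n) → Bool} →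
                             Triangular E β false → Ladder (IsTrue E) n
ladder-of-triangular-false {β = false} T =
  inject₁ , fsuc , triangular⇔≤ (triangular-shift T)
ladder-of-triangular-false {β = true}  T =
  opposite ∘ inject₁ , opposite ∘ fsuc , triangular⇔≤ (triangular-shift (triangular-reverse T))

module _ {m} (entry : Fin m → Fin m × Bool → Bool)
  (sides-differ : ∀ {i j} → i ≤ᶠ j → entry i (j , false) ≡ not (entry i (j , true)))
  (sides-agree  : ∀ {i j} → j <ᶠ i → entry i (j , false) ≡ entry i (j , true)) where

  entry-xor-side : ∀ {i j} → i ≤ᶠ j → ∀ c b → entry i (j , c xor b) ≡ c xor entry i (j , b)
  entry-xor-side i≤j false b     = refl
  entry-xor-side i≤j true  true  = sides-differ i≤j
  entry-xor-side i≤j true  false =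
    trans (sym (not-involutive _)) (cong not (sym (sides-differ i≤j)))

  entry-below : ∀ {i j} → j <ᶠ i → ∀ b → entry i (j , b) ≡ entry i (j , true)
  entry-below j<i true  = refl
  entry-below j<i false = sides-agree j<i

  trueSide : Fin m → Bool
  trueSide j = entry j (j , true)

  entry-trueSide : ∀ j → entry j (j , trueSide j) ≡ true
  entry-trueSide j with entry j (j , true) in e
  ... | true  = e
  ... | false = trans (sides-differ ℕ.≤-refl) (cong not e)

  sideWithDiagonal : Bool → Fin m → Bool
  sideWithDiagonal d j = not d xor trueSide j

  entry-sideWithDiagonal : ∀ d j → entry j (j , sideWithDiagonal d j) ≡ d
  entry-sideWithDiagonal d j = begin
    entry j (j , not d xor trueSide j) ≡⟨ entry-xor-side ℕ.≤-refl (not d) _ ⟩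
    not d xor entry j (j , trueSide j) ≡⟨ cong (not d xor_) (entry-trueSide j) ⟩
    not d xor true                     ≡⟨ xor-comm (not d) true ⟩
    not (not d)                        ≡⟨ not-involutive d ⟩
    d                                  ∎
    where open ≡-Reasoning

  module _ {r} (β : Bool) (F : Fin r → Fin m)
    (F-increasing : ∀ x y → x <ᶠ y → F x <ᶠ F y)
    (F-below : ∀ x y → x <ᶠ y → entry (F y) (F x , true) ≡ β) where

    aboveDiffersFromBelow : Fin r → Fin r → Bool
    aboveDiffersFromBelow x y = entry (F x) (F y , trueSide (F y)) xor β

    column : ∀ {K} → Bool → (Fin K → Fin r) → Fin K → Fin m × Bool
    column γ H t = F (H t) , sideWithDiagonal γ (F (H t))

    clique-triangular :
      ∀ {K} (γ : Bool) (H : Fin K → Fin r) →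
      (∀ s t → s <ᶠ t → H s <ᶠ H t) →
      (∀ s t → s <ᶠ t → aboveDiffersFromBelow (H s) (H t) ≡ γ) →
      Triangular (λ s t → entry (F (H s)) (column γ H t)) β γ
    clique-triangular γ H H-increasing H-colour = record
      { above = λ {s} {t} s<t →
          let x = F (H s) ; y = F (H t) in begin
          entry x (y , sideWithDiagonal γ y) ≡⟨ entry-xor-side (ℕ.<⇒≤ (increasing s<t)) (not γ) _ ⟩
          not γ xor entry x (y , trueSide y) ≡⟨ cong (not γ xor_) (xor-solveˡ (H-colour s t s<t)) ⟩
          not γ xor (γ xor β)                ≡⟨ xor-assoc (not γ) γ β ⟨
          (not γ xor γ) xor β                ≡⟨ cong (_xor β) (xor-inverseˡ γ) ⟩
          not β                              ∎
      ; diagonal = λ s → entry-sideWithDiagonal γ (F (H s))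
      ; below = λ {s} {t} t<s →
          trans (entry-below (increasing t<s) _) (F-below (H t) (H s) (H-increasing t s t<s))
      }
      where
      open ≡-Reasoning
      increasing : ∀ {s t} → s <ᶠ t → F (H s) <ᶠ F (H t)
      increasing {s} {t} s<t = F-increasing (H s) (H t) (H-increasing s t s<t)

    ladder-below-constant : ∀ {k} → Arrows r k (suc k) → Ladder (IsTrue entry) k
    ladder-below-constant arrows with arrows aboveDiffersFromBelow
    ... | inj₁ (H , H-increasing , H-colour) =
      ladder-comap {R = IsTrue entry} (F ∘ H) (column true H)
        (ladder-of-triangular-true (clique-triangular true H H-increasing H-colour))
    ... | inj₂ (H , H-increasing , H-colour) =
      ladder-comap {R = IsTrue entry} (F ∘ H) (column false H)
        (ladder-of-triangular-false (clique-triangular false H H-increasing H-colour))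

  alternating-ladder : ∀ {r k} → Arrows m r r → Arrows r k (suc k) →
                       Ladder (IsTrue entry) k
  alternating-ladder arrows₂ arrows₁ with arrows₂ (λ u v → entry v (u , true))
  ... | inj₁ (F , F-increasing , F-colour) = ladder-below-constant true F F-increasing F-colour arrows₁
  ... | inj₂ (F , F-increasing , F-colour) = ladder-below-constant false F F-increasing F-colour arrows₁

module _ {c ℓ} (G : Group c ℓ) (A : Group.Carrier G → Set p) (resp : Respects≈ G A) where
  open Group G using (Carrier; _∙_; _⁻¹; ∙-congʳ) renaming (sym to ≈-sym; trans to ≈-trans)
  open import Algebra.Properties.Group G using (//-rightDividesˡ; //-rightDividesʳ)

  inRightTranslate⇔ : ∀ w x → InRightTranslate G A w x ⇔ A (x ∙ w ⁻¹)
  inRightTranslate⇔ w x = mk⇔ to from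
    where
    to : InRightTranslate G A w x → A (x ∙ w ⁻¹)
    to (a , a∈A , x≈aw) = resp (≈-sym (≈-trans (∙-congʳ x≈aw) (//-rightDividesʳ w a))) a∈A
    from : A (x ∙ w ⁻¹) → InRightTranslate G A w x
    from xw⁻¹∈A = x ∙ w ⁻¹ , xw⁻¹∈A , ≈-sym (//-rightDividesˡ w x)

  ¬¬-ladder-of-φ-ladder : ∀ {n r k} → Arrows n r r → Arrows r k (suc k) →
                          Ladder (φ G A) n → ¬ ¬ Ladder (λ x y → A (x ∙ y)) k
  ¬¬-ladder-of-φ-ladder {n} {r} {k} arrows₂ arrows₁ (xs , yzs , φ-ladder) =
    ¬¬-map ladder (¬¬-∀-Fin λ _ → ¬¬-∀-Fin λ _ → ¬¬-∀-Bool λ _ → ¬¬-excluded-middle)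
    where
    translate : Fin n × Bool → Carrier
    translate (j , b) = if b then proj₁ (yzs j) else proj₂ (yzs j)

    Member : Fin n → Fin n × Bool → Set (c ⊔ ℓ ⊔ p)
    Member i c = InRightTranslate G A (translate c) (xs i)

    ladder : (∀ i j b → Dec (Member i (j , b))) → Ladder (λ x y → A (x ∙ y)) k
    ladder member? =
      ladder-map {R = IsTrue entry} {S = λ x y → A (x ∙ y)} xs (λ c → translate c ⁻¹)
        (λ i c → ⇔.trans (⇔.sym (inRightTranslate⇔ (translate c) (xs i)))
                         (⇔.sym (does≡true⇔ (member? i (proj₁ c) (proj₂ c)))))
        (alternating-ladder entry sides-differ sides-agree arrows₂ arrows₁)
      where
      entry : Fin n → Fin n × Bool → Bool
      entry i (j , b) = does (member? i j b)
      sides-differ : ∀ {i j} → i ≤ᶠ j → entry i (j , false) ≡ not (entry i (j , true))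
      sides-differ {i} {j} i≤j =
        does-exclusive (member? i j true) (member? i j false) (Equivalence.from (φ-ladder i j) i≤j)
      sides-agree : ∀ {i j} → j <ᶠ i → entry i (j , false) ≡ entry i (j , true)
      sides-agree {i} {j} j<i =
        does-nonexclusive (member? i j true) (member? i j false)
          (ℕ.<⇒≱ j<i ∘ Equivalence.to (φ-ladder i j))

proposition3p5 : ∀ {c ℓ p} (G : Group c ℓ) (k : ℕ) → 2 ≤ k →
    (A : Group.Carrier G → Set p) → Respects≈ G A → SetStable G A k →
    (r₁ r₂ : ℕ) → IsRamseyNumber k (suc k) r₁ → IsRamseyNumber r₁ r₁ r₂ →
    RelStable (φ G A) (suc r₂)
proposition3p5 G k _ A resp stable r₁ r₂ (arrows₁ , _) (arrows₂ , _) φ-ladder =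
  ¬¬-ladder-of-φ-ladder G A resp arrows₂ arrows₁ (ladder-shrink {R = φ G A} (ℕ.n≤1+n r₂) φ-ladder) stable
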